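{- For every integer $k\ge1$, $t(k)=\frac{k+2}{2}$ if $k$ is even and $t(k)=\frac{k+1}{2}$ if $k$ is odd.
   Context: Fix $k\ge1$. Let $\Sigma_k$ be the set of all tuples $(j_1,\dots,j_k)$ of non-negative integers with $j_1+2j_2+\cdots+kj_k=k$ (these index the terms $\prod_{i=1}^k \frac{(-p_i)^{j_i}}{j_i!\,i^{j_i}}$ in the Girard–Newton expression $e_k=(-1)^k\sum\prod_{i=1}^k\frac{(-p_i)^{j_i}}{j_i!\,i^{j_i}}$ of the elementary symmetric polynomial $e_k$ in terms of the power sums $p_i$). A set $T$ of power sum polynomials (equivalently a set $T\subseteq\{1,\dots,k\}$ of indices) is a dominating set for $e_k$ if for every $(j_1,\dots,j_k)\in\Sigma_k$ there is $i\in T$ with $j_i\ge1$. $t(k)$ denotes the minimum size of a dominating set for $e_k$. -}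

module Defs where

open import Data.Nat using (ℕ; zero; suc; _+_; _*_; _≤_; _≥_)
open import Data.Fin using (Fin; toℕ)
open import Data.Fin.Subset using (Subset; _∈_; ∣_∣)
open import Data.Product using (Σ; ∃-syntax; _×_; _,_)
open import Relation.Binary.PropositionalEquality using (_≡_)

sumFin : (n : ℕ) → (Fin n → ℕ) → ℕ
sumFin zero    f = 0
sumFin (suc n) f = f Fin.zero + sumFin n (λ i → f (Fin.suc i))

-- A tuple (j₁,…,j_k) is a function j : Fin k → ℕ with j i = j_{toℕ i + 1}.
-- Σ_k : tuples with j₁ + 2 j₂ + ⋯ + k j_k = k.
InSigma : (k : ℕ) → (Fin k → ℕ) → Set
InSigma k j = sumFin k (λ i → suc (toℕ i) * j i) ≡ k

-- T ⊆ {1,…,k} represented as a Subset k (index i ↔ power sum p_{toℕ i + 1}).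
-- T dominates e_k: every (j₁,…,j_k) ∈ Σ_k has some i ∈ T with j_i ≥ 1.
Dominating : (k : ℕ) → Subset k → Set
Dominating k T = (j : Fin k → ℕ) → InSigma k j → ∃[ i ] (i ∈ T × j i ≥ 1)

IsMinDominatingSize : (k : ℕ) → ℕ → Set
IsMinDominatingSize k m =
  (∃[ T ] (Dominating k T × ∣ T ∣ ≡ m)) × ((T : Subset k) → Dominating k T → m ≤ ∣ T ∣)

module Submission where

-- With h = ⌊k/2⌋, the set {p₁, …, p_h, p_k} dominates e_k: a partition of k
-- avoiding it has all parts in [h + 1, k − 1], so it has at least two parts
-- and k ≥ 2 (h + 1), which is impossible. Conversely the h + 1 partitions
-- (k), (1, k − 1), …, (h, k − h) have pairwise disjoint supports (a part v is
-- determined by min(v, k − v)), so every dominating set has h + 1 elements.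
-- Finally (k + 2)/2 and, for odd k, (k + 1)/2 both equal h + 1.

open import Defs
open import Data.Nat using (ℕ; _+_; _≥_; _/_)
open import Data.Nat.Divisibility using (_∣_)
open import Relation.Nullary using (¬_)
open import Data.Product using (_×_)

open import Data.Nat using (zero; suc; _*_; _∸_; _⊓_; _≤_; _<_; _≡ᵇ_; z≤n; s≤s; _≤?_)
open import Data.Nat.Properties
open import Data.Nat.DivMod using (_%_; m≡m%n+[m/n]*n; m%n<n; m/n*n≤m; m/n<m; m*n/n≡m; m/n≡1+[m∸n]/n)
open import Data.Nat.Divisibility using (m%n≡0⇒n∣m)
open import Data.Bool using (true; if_then_else_; T)
open import Data.Unit using (tt)
open import Data.Fin using (Fin; zero; suc; toℕ)
open import Data.Fin.Properties using (any?; injective⇒≤; toℕ-injective; toℕ≤pred[n])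
import Data.Fin.Properties as Fin
open import Data.Fin.Subset using (Subset; _∈_; _∉_; ∣_∣; inside; outside)
open import Data.Fin.Subset.Properties using (_∈?_)
open import Data.Vec using ([]; _∷_; here; there)
open import Data.Vec.Functional using (Vector)
open import Data.Product using (∃-syntax; _,_; proj₁; proj₂)
open import Data.Sum using (inj₁; inj₂)
open import Data.Empty using (⊥; ⊥-elim)
open import Function using (_∘_)
open import Function.Definitions using (Injective)
open import Relation.Nullary using (yes; no; contradiction)
open import Relation.Nullary.Decidable using (_×-dec_)
open import Relation.Binary.PropositionalEquality
open import Algebra.Properties.Semiring.Sum +-*-semiring
  using (sum; sum-syntax; sum-cong-≗; sum-replicate-zero; ∑-distrib-+; *-distribˡ-sum)

sumFin≡sum : ∀ n (f : Vector ℕ n) → sumFin n f ≡ sum f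
sumFin≡sum zero    f = refl
sumFin≡sum (suc n) f = cong (f zero +_) (sumFin≡sum n (f ∘ suc))

sum-mono-≤ : ∀ {n} {f g : Vector ℕ n} → (∀ i → f i ≤ g i) → sum f ≤ sum g
sum-mono-≤ {zero}  _   = z≤n
sum-mono-≤ {suc n} f≤g = +-mono-≤ (f≤g zero) (sum-mono-≤ (f≤g ∘ suc))

∑-*-zero : ∀ {n} (f : Vector ℕ n) → ∑[ i < n ] (f i * 0) ≡ 0
∑-*-zero {n} f = trans (sum-cong-≗ (λ i → *-zeroʳ (f i))) (sum-replicate-zero n)

weight : ∀ {k} → Vector ℕ k → ℕ
weight {k} j = ∑[ i < k ] (suc (toℕ i) * j i)

InSigma⇒weight≡ : ∀ {k j} → InSigma k j → weight j ≡ k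
InSigma⇒weight≡ {k} = trans (sym (sumFin≡sum k _))

weight≡⇒InSigma : ∀ {k j} → weight j ≡ k → InSigma k j
weight≡⇒InSigma {k} = trans (sumFin≡sum k _)

weight-+ : ∀ {k} (j j′ : Vector ℕ k) → weight (λ i → j i + j′ i) ≡ weight j + weight j′
weight-+ j j′ = trans (sum-cong-≗ (λ i → *-distribˡ-+ (suc (toℕ i)) (j i) (j′ i)))
                      (∑-distrib-+ (λ i → suc (toℕ i) * j i) (λ i → suc (toℕ i) * j′ i))

weight-bounds : ∀ {k lo hi} (j : Vector ℕ k) →
  (∀ i → j i ≥ 1 → lo ≤ suc (toℕ i) × suc (toℕ i) ≤ hi) →
  lo * sum j ≤ weight j × weight j ≤ hi * sum j
weight-bounds {k} {lo} {hi} j bounded =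
  subst (_≤ weight j) (sym (*-distribˡ-sum lo j)) (sum-mono-≤ (scale (λ i → proj₁ ∘ bounded i))) ,
  subst (weight j ≤_) (sym (*-distribˡ-sum hi j)) (sum-mono-≤ (scale (λ i → proj₂ ∘ bounded i)))
  where
  scale : ∀ {f g : Fin k → ℕ} → (∀ i → j i ≥ 1 → f i ≤ g i) → ∀ i → f i * j i ≤ g i * j i
  scale {f} {g} f≤g i with j i | f≤g i
  ... | zero  | _  = ≤-reflexive (trans (*-zeroʳ (f i)) (sym (*-zeroʳ (g i))))
  ... | suc m | le = *-monoˡ-≤ (suc m) (le (s≤s z≤n))

-- The multiplicity vector of the one-part partition (v) of v: the part v sits at
-- position v ∸ 1, and v = 0 gives the empty partition.
single : ∀ {k} → ℕ → Vector ℕ k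
single zero    i = 0
single (suc p) i = if toℕ i ≡ᵇ p then 1 else 0

∑-single : ∀ {k} (f : ℕ → ℕ) {p} → p < k →
  ∑[ i < k ] (f (toℕ i) * single (suc p) i) ≡ f p
∑-single {suc k} f {zero} _ = begin
  f 0 * 1 + ∑[ i < k ] (f (suc (toℕ i)) * 0)
    ≡⟨ cong₂ _+_ (*-identityʳ (f 0)) (∑-*-zero {k} (λ i → f (suc (toℕ i)))) ⟩
  f 0 + 0
    ≡⟨ +-identityʳ (f 0) ⟩
  f 0 ∎
  where open ≡-Reasoning
∑-single {suc k} f {suc p} (s≤s p<k) = begin
  f 0 * 0 + ∑[ i < k ] (f (suc (toℕ i)) * single (suc p) i)
    ≡⟨ cong (_+ ∑[ i < k ] (f (suc (toℕ i)) * single (suc p) i)) (*-zeroʳ (f 0)) ⟩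
  ∑[ i < k ] (f (suc (toℕ i)) * single (suc p) i)
    ≡⟨ ∑-single (f ∘ suc) p<k ⟩
  f (suc p) ∎
  where open ≡-Reasoning

weight-single : ∀ {k v} → v ≤ k → weight {k} (single v) ≡ v
weight-single {k} {zero}  _   = ∑-*-zero {k} (λ i → suc (toℕ i))
weight-single {k} {suc p} p<k = ∑-single suc p<k

single-support : ∀ {k} v (i : Fin k) → single v i ≥ 1 → suc (toℕ i) ≡ v
single-support (suc p) i hit with toℕ i ≡ᵇ p in eq
... | true = cong suc (≡ᵇ⇒≡ (toℕ i) p (subst T (sym eq) tt))

rank : ∀ {n} (p : Subset n) {x} → x ∈ p → Fin ∣ p ∣
rank (inside  ∷ p) here        = zero
rank (inside  ∷ p) (there x∈p) = suc (rank p x∈p)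
rank (outside ∷ p) (there x∈p) = rank p x∈p

rank-injective : ∀ {n} (p : Subset n) {x y} (x∈p : x ∈ p) (y∈p : y ∈ p) →
  rank p x∈p ≡ rank p y∈p → x ≡ y
rank-injective (inside  ∷ p) here        here        _  = refl
rank-injective (inside  ∷ p) (there x∈p) (there y∈p) eq =
  cong suc (rank-injective p x∈p y∈p (Fin.suc-injective eq))
rank-injective (outside ∷ p) (there x∈p) (there y∈p) eq =
  cong suc (rank-injective p x∈p y∈p eq)

injective-into⇒≤∣p∣ : ∀ {m n} (p : Subset n) (f : Fin m → Fin n) →
  Injective _≡_ _≡_ f → (∀ a → f a ∈ p) → m ≤ ∣ p ∣
injective-into⇒≤∣p∣ p f f-inj f∈p = injective⇒≤ {f = λ a → rank p (f∈p a)}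
  (λ eq → f-inj (rank-injective p (f∈p _) (f∈p _) eq))

-- T meets each support, and disjointness makes the meeting points distinct.
disjointly-supported⇒≤∣T∣ : ∀ {k m} (tuple : Fin m → Vector ℕ k) →
  (∀ a → InSigma k (tuple a)) →
  (∀ {a b} i → tuple a i ≥ 1 → tuple b i ≥ 1 → a ≡ b) →
  (T : Subset k) → Dominating k T → m ≤ ∣ T ∣
disjointly-supported⇒≤∣T∣ tuple tuple∈Σ disjoint T dominating =
  injective-into⇒≤∣p∣ T (proj₁ ∘ hit) hit-injective (proj₁ ∘ proj₂ ∘ hit)
  where
  hit : ∀ a → ∃[ i ] (i ∈ T × tuple a i ≥ 1)
  hit a = dominating (tuple a) (tuple∈Σ a)
  hit-injective : Injective _≡_ _≡_ (proj₁ ∘ hit)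
  hit-injective {a} {b} eq =
    disjoint _ (proj₂ (proj₂ (hit a))) (subst (λ i → tuple b i ≥ 1) (sym eq) (proj₂ (proj₂ (hit b))))

-- The partition (a, k ∸ a) of k; for a = 0 this is the one-part partition (k).
twoParts : ∀ k → ℕ → Vector ℕ k
twoParts k a i = single a i + single (k ∸ a) i

twoParts∈Σ : ∀ {k a} → a ≤ k → InSigma k (twoParts k a)
twoParts∈Σ {k} {a} a≤k = weight≡⇒InSigma {j = twoParts k a} (begin
  weight (twoParts k a)                               ≡⟨ weight-+ {k} (single a) (single (k ∸ a)) ⟩
  weight {k} (single a) + weight {k} (single (k ∸ a)) ≡⟨ cong₂ _+_ (weight-single a≤k)
                                                                    (weight-single (m∸n≤m k a)) ⟩
  a + (k ∸ a)                                         ≡⟨ m+[n∸m]≡n a≤k ⟩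
  k                                                   ∎)
  where open ≡-Reasoning

balance : ℕ → ℕ → ℕ
balance k v = v ⊓ (k ∸ v)

balance-≤half : ∀ {k v} → v ≤ k ∸ v → balance k v ≡ v
balance-≤half = m≤n⇒m⊓n≡m

balance-complement : ∀ {k v} → v ≤ k → balance k (k ∸ v) ≡ balance k v
balance-complement {k} {v} v≤k =
  trans (cong ((k ∸ v) ⊓_) (m∸[m∸n]≡n v≤k)) (⊓-comm (k ∸ v) v)

-- Hence for distinct a ≤ k/2 the supports of twoParts k a are disjoint.
balance-twoParts : ∀ {k a} → a ≤ k ∸ a → (i : Fin k) → twoParts k a i ≥ 1 →
  balance k (suc (toℕ i)) ≡ a
balance-twoParts {k} {a} a≤k∸a i hit with single a i in eq
... | suc _ = begin
  balance k (suc (toℕ i)) ≡⟨ cong (balance k) (single-support a i (subst (_≥ 1) (sym eq) (s≤s z≤n))) ⟩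
  balance k a             ≡⟨ balance-≤half a≤k∸a ⟩
  a                       ∎
  where open ≡-Reasoning
... | zero = begin
  balance k (suc (toℕ i)) ≡⟨ cong (balance k) (single-support (k ∸ a) i hit) ⟩
  balance k (k ∸ a)       ≡⟨ balance-complement (≤-trans a≤k∸a (m∸n≤m k a)) ⟩
  balance k a             ≡⟨ balance-≤half a≤k∸a ⟩
  a                       ∎
  where open ≡-Reasoning

dominating⇒h<∣T∣ : ∀ {k h} → h ≤ k ∸ h → (T : Subset k) → Dominating k T → suc h ≤ ∣ T ∣
dominating⇒h<∣T∣ {k} {h} h≤k∸h =
  disjointly-supported⇒≤∣T∣ (λ a → twoParts k (toℕ a))
    (λ a → twoParts∈Σ (≤-trans (≤half a) (m∸n≤m k (toℕ a))))
    (λ {a} {b} i hit-a hit-b → toℕ-injective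
      (trans (sym (balance-twoParts (≤half a) i hit-a)) (balance-twoParts (≤half b) i hit-b)))
  where
  ≤half : (a : Fin (suc h)) → toℕ a ≤ k ∸ toℕ a
  ≤half a = ≤-trans (toℕ≤pred[n] a) (≤-trans h≤k∸h (∸-monoʳ-≤ k (toℕ≤pred[n] a)))

-- The set {p₁, …, p_h, p_k} for k = suc n.
lowAndLast : (n h : ℕ) → Subset (suc n)
lowAndLast zero    h       = inside ∷ []
lowAndLast (suc n) zero    = outside ∷ lowAndLast n zero
lowAndLast (suc n) (suc h) = inside ∷ lowAndLast n h

∣lowAndLast∣ : ∀ {n h} → h ≤ n → ∣ lowAndLast n h ∣ ≡ suc h
∣lowAndLast∣ {zero}  z≤n       = refl
∣lowAndLast∣ {suc n} z≤n       = ∣lowAndLast∣ {n} z≤n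
∣lowAndLast∣ {suc n} (s≤s h≤n) = cong suc (∣lowAndLast∣ h≤n)

∉lowAndLast : ∀ n h (i : Fin (suc n)) → i ∉ lowAndLast n h → h ≤ toℕ i × toℕ i < n
∉lowAndLast zero    h       zero    i∉ = contradiction here i∉
∉lowAndLast (suc n) zero    zero    i∉ = z≤n , s≤s z≤n
∉lowAndLast (suc n) zero    (suc i) i∉ =
  z≤n , s≤s (proj₂ (∉lowAndLast n zero i (i∉ ∘ there)))
∉lowAndLast (suc n) (suc h) zero    i∉ = contradiction here i∉
∉lowAndLast (suc n) (suc h) (suc i) i∉ with ∉lowAndLast n h i (i∉ ∘ there)
... | h≤i , i<n = s≤s h≤i , s≤s i<n

lowAndLast-dominating : ∀ {n h} → n ≤ h * 2 → Dominating (suc n) (lowAndLast n h)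
lowAndLast-dominating {n} {h} n≤2h j j∈Σ
  with any? (λ i → i ∈? lowAndLast n h ×-dec 1 ≤? j i)
... | yes hit  = hit
... | no  miss = ⊥-elim (too-few-or-too-many (sum j) (proj₁ bounds) (proj₂ bounds))
  where
  middle : ∀ i → j i ≥ 1 → suc h ≤ suc (toℕ i) × suc (toℕ i) ≤ n
  middle i j≥1 with ∉lowAndLast n h i (λ i∈ → miss (i , i∈ , j≥1))
  ... | h≤i , i<n = s≤s h≤i , i<n
  bounds : suc h * sum j ≤ suc n × suc n ≤ n * sum j
  bounds = subst (λ w → suc h * sum j ≤ w × w ≤ n * sum j) (InSigma⇒weight≡ {j = j} j∈Σ)
                 (weight-bounds j middle)
  too-few-or-too-many : ∀ N → suc h * N ≤ suc n → suc n ≤ n * N → ⊥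
  too-few-or-too-many zero          _  k≤ = contradiction (subst (suc n ≤_) (*-zeroʳ n) k≤) λ ()
  too-few-or-too-many (suc zero)    _  k≤ = <-irrefl refl (subst (suc n ≤_) (*-identityʳ n) k≤)
  too-few-or-too-many (suc (suc N)) ≤k _  =
    <-irrefl refl (≤-trans (*-monoʳ-≤ (suc h) (s≤s (s≤s (z≤n {N})))) (≤-trans ≤k (s≤s n≤2h)))

isMinDominatingSize[1+k/2] : ∀ n → IsMinDominatingSize (suc n) (suc (suc n / 2))
isMinDominatingSize[1+k/2] n =
  (lowAndLast n h , lowAndLast-dominating n≤2h , ∣lowAndLast∣ h≤n) , dominating⇒h<∣T∣ h≤k∸h
  where
  h : ℕ
  h = suc n / 2
  n≤2h : n ≤ h * 2
  n≤2h = ≤-pred (begin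
    suc n              ≡⟨ m≡m%n+[m/n]*n (suc n) 2 ⟩
    suc n % 2 + h * 2  ≤⟨ +-monoˡ-≤ (h * 2) (≤-pred (m%n<n (suc n) 2)) ⟩
    suc (h * 2)        ∎)
    where open ≤-Reasoning
  h≤n : h ≤ n
  h≤n = ≤-pred (m/n<m (suc n) 2 (s≤s (s≤s z≤n)))
  h≤k∸h : h ≤ suc n ∸ h
  h≤k∸h = m+n≤o⇒m≤o∸n h (subst (_≤ suc n) (trans (*-comm h 2) (cong (h +_) (+-identityʳ h)))
                                          (m/n*n≤m (suc n) 2))

[k+2]/2≡1+k/2 : ∀ k → (k + 2) / 2 ≡ suc (k / 2)
[k+2]/2≡1+k/2 k = trans (m/n≡1+[m∸n]/n (m≤n+m 2 k)) (cong (λ m → suc (m / 2)) (m+n∸n≡m k 2))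

odd⇒[k+1]/2≡1+k/2 : ∀ k → ¬ (2 ∣ k) → (k + 1) / 2 ≡ suc (k / 2)
odd⇒[k+1]/2≡1+k/2 k odd with n≤1⇒n≡0∨n≡1 (≤-pred (m%n<n k 2))
... | inj₁ k%2≡0 = contradiction (m%n≡0⇒n∣m k 2 k%2≡0) odd
... | inj₂ k%2≡1 = begin
  (k + 1) / 2                 ≡⟨ cong (_/ 2) (+-comm k 1) ⟩
  suc k / 2                   ≡⟨ cong (λ m → suc m / 2) (m≡m%n+[m/n]*n k 2) ⟩
  suc (k % 2 + k / 2 * 2) / 2 ≡⟨ cong (λ r → suc (r + k / 2 * 2) / 2) k%2≡1 ⟩
  suc (k / 2) * 2 / 2         ≡⟨ m*n/n≡m (suc (k / 2)) 2 ⟩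
  suc (k / 2)                 ∎
  where open ≡-Reasoning

lemma17 : (k : ℕ) → k ≥ 1 →
    ((2 ∣ k) → IsMinDominatingSize k ((k + 2) / 2)) ×
    ((¬ (2 ∣ k)) → IsMinDominatingSize k ((k + 1) / 2))
lemma17 (suc n) _ =
  (λ _   → subst (IsMinDominatingSize (suc n)) (sym ([k+2]/2≡1+k/2 (suc n))) t) ,
  (λ odd → subst (IsMinDominatingSize (suc n)) (sym (odd⇒[k+1]/2≡1+k/2 (suc n) odd)) t)
  where
  t : IsMinDominatingSize (suc n) (suc (suc n / 2))
  t = isMinDominatingSize[1+k/2] n
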